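{- Let $G\supseteq \mathrm{Aut}(\Delta)$ be a closed permutation group on $D$, let $c_1,\ldots,c_n\in D$, and let $f\colon(\Delta,c_1,\ldots,c_n)\rightarrow\Delta$ be an order preserving canonical function generated by $G$. Assume that $f$ keeps the graph relation on $D\setminus\{c_1,\ldots,c_n\}$. Assume moreover that there exist distinct levels $L_1,L_2,L_3$ of $(\Delta,c_1,\ldots,c_n)$ and $1\leq i\leq n$ with $L_1<\{c_i\}<L_2$ and $\{c_i\}<L_3$ such that $f$ keeps the graph relation between $\{c_i\}$ and $L_1\cup L_3$, and $f$ flips the graph relation between $\{c_i\}$ and $L_2$. Then $G\supseteq \mathrm{Aut}(D;<)$.
   Context: $\Delta=(D;<,E)$ denotes the random ordered graph: the Fraïssé limit of the class of all finite simple undirected graphs equipped with a linear order; $D$ is countable, $<$ a dense linear order without endpoints, $E$ the edge relation. $\mathrm{Aut}(D;<)$ is the group of all order preserving permutations of $D$. A permutation group on $D$ is closed if it is closed in the topology of pointwise convergence. For $c_1,\ldots,c_n\in D$, $\mathrm{Aut}(\Delta,c_1,\ldots,c_n)$ is the stabilizer of $c_1,\ldots,c_n$ in $\mathrm{Aut}(\Delta)$; the orbits of $(\Delta,c_1,\ldots,c_n)$ are the orbits of this group on $D$, the infinite ones being those other than the singletons $\{c_i\}$. A level of $(\Delta,c_1,\ldots,c_n)$ is the set of elements of $D\setminus\{c_1,\ldots,c_n\}$ lying in one of the open intervals of $(D;<)$ determined by $c_1,\ldots,c_n$ (a union of infinite orbits). For $P,Q\subseteq D$, $P<Q$ means $p<q$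 for all $p\in P,q\in Q$. A function $f\colon D\to D$ is canonical $(\Delta,c_1,\ldots,c_n)\rightarrow\Delta$ if for all $k\ge1$ and all $k$-tuples $a,b$ in the same orbit of $\mathrm{Aut}(\Delta,c_1,\ldots,c_n)$, $f(a)$ and $f(b)$ lie in the same orbit of $\mathrm{Aut}(\Delta)$; it is order preserving if $x<y$ implies $f(x)<f(y)$. For $P,Q\subseteq D$, $f$ keeps the graph relation between $P$ and $Q$ if for all distinct $p\in P,q\in Q$: $E(p,q)\Leftrightarrow E(f(p),f(q))$; it flips it if $E(p,q)\Leftrightarrow\neg E(f(p),f(q))$; "on $P$" means "between $P$ and $P$". $f$ is generated by a closed group $G$ if for every finite $A\subseteq D$ some $g\in G$ agrees with $f$ on $A$. -}

module Defs where

open import Data.Nat using (ℕ)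
open import Data.Fin using (Fin)
open import Data.Maybe using (Maybe; just; nothing)
open import Data.List using (List)
open import Data.List.Membership.Propositional using (_∈_)
open import Data.Product using (Σ; ∃; _×_; _,_)
open import Data.Unit using (⊤)
open import Data.Sum using (_⊎_)
open import Data.Empty using (⊥)
open import Function using (_∘_; _⇔_)
open import Function.Bundles using (Inverse; _↔_)
open import Relation.Nullary using (¬_; Dec)
open import Relation.Binary using (IsStrictTotalOrder)
open import Relation.Binary.PropositionalEquality using (_≡_; _≢_)

-- The random ordered graph Δ = (D; <, E), axiomatised by its Fraïssé
-- characterisation: a countable ordered graph with the one-point
-- extension property (which also yields density and no endpoints).

record RandomOrderedGraph (D : Set) : Set₁ where
  field
    _<_        : D → D → Set
    E          : D → D → Set
    <-isSTO    : IsStrictTotalOrder _≡_ _<_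
    E-irrefl   : ∀ x → ¬ E x x
    E-sym      : ∀ x y → E x y → E y x
    E-dec      : ∀ x y → Dec (E x y)
    enum       : ℕ → D
    enum-surj  : ∀ x → ∃ λ k → enum k ≡ x
    extension  : (Lo Hi V W : List D) →
                 (∀ a b → a ∈ Lo → b ∈ Hi → a < b) →
                 (∀ v → v ∈ V → v ∈ W → ⊥) →
                 ∃ λ x → (∀ a → a ∈ Lo → a < x) × (∀ b → b ∈ Hi → x < b)
                       × (∀ v → v ∈ V → E x v)
                       × (∀ w → w ∈ W → ¬ E x w × x ≢ w)

Perm : Set → Set
Perm D = D ↔ D

module Notions {D : Set} (Δ : RandomOrderedGraph D) where
  open RandomOrderedGraph Δ
  open Inverse

  record IsPermGroup (G : Perm D → Set) : Set₁ where
    field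
      ext   : ∀ g h → (∀ x → to g x ≡ to h x) → G g → G h
      idG   : ∀ g → (∀ x → to g x ≡ x) → G g
      comp  : ∀ g h k → (∀ x → to k x ≡ to g (to h x)) → G g → G h → G k
      inv   : ∀ g h → (∀ x → to h (to g x) ≡ x) → G g → G h

  Closed : (Perm D → Set) → Set
  Closed G = ∀ g → (∀ (A : List D) → ∃ λ h → G h × (∀ a → a ∈ A → to h a ≡ to g a)) → G g

  IsAutOrder : Perm D → Set
  IsAutOrder g = ∀ x y → (x < y) ⇔ (to g x < to g y)

  IsAut : Perm D → Set
  IsAut g = IsAutOrder g × (∀ x y → E x y ⇔ E (to g x) (to g y))

  IsAutC : {n : ℕ} → (Fin n → D) → Perm D → Set
  IsAutC c g = IsAut g × (∀ i → to g (c i) ≡ c i)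

  SameOrbit : (Perm D → Set) → {k : ℕ} → (Fin k → D) → (Fin k → D) → Set
  SameOrbit H a b = ∃ λ g → H g × (∀ j → to g (a j) ≡ b j)

  Canonical : {n : ℕ} → (Fin n → D) → (D → D) → Set
  Canonical c f = ∀ (k : ℕ) (a b : Fin k → D) →
    SameOrbit (IsAutC c) a b → SameOrbit IsAut (f ∘ a) (f ∘ b)

  OrderPreserving : (D → D) → Set
  OrderPreserving f = ∀ x y → x < y → f x < f y

  GeneratedBy : (Perm D → Set) → (D → D) → Set
  GeneratedBy G f = ∀ (A : List D) → ∃ λ g → G g × (∀ a → a ∈ A → to g a ≡ f a)

  Keeps : (D → D) → (D → Set) → (D → Set) → Set
  Keeps f P Q = ∀ p q → P p → Q q → p ≢ q → E p q ⇔ E (f p) (f q)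

  Flips : (D → D) → (D → Set) → (D → Set) → Set
  Flips f P Q = ∀ p q → P p → Q q → p ≢ q → E p q ⇔ (¬ E (f p) (f q))

  NonConst : {n : ℕ} → (Fin n → D) → D → Set
  NonConst c x = ∀ i → x ≢ c i

  Singleton : D → D → Set
  Singleton a x = x ≡ a

  _∪_ : (D → Set) → (D → Set) → D → Set
  (P ∪ Q) x = P x ⊎ Q x

  -- Strict bounds with ±∞ (nothing = unbounded).
  AboveLo : {n : ℕ} → (Fin n → D) → Maybe (Fin n) → D → Set
  AboveLo c nothing  x = ⊤
  AboveLo c (just j) x = c j < x

  BelowHi : {n : ℕ} → (Fin n → D) → Maybe (Fin n) → D → Set
  BelowHi c nothing  x = ⊤
  BelowHi c (just j) x = x < c j

  -- A level of (Δ, c): the open interval between two consecutive cut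
  -- points among c₁,…,cₙ (or −∞ / +∞).
  record Level {n : ℕ} (c : Fin n → D) : Set where
    field
      lo hi       : Maybe (Fin n)
      lo<hi       : ∀ i j → lo ≡ just i → hi ≡ just j → c i < c j
      consecutive : ∀ i → AboveLo c lo (c i) → BelowHi c hi (c i) → ⊥

  InLevel : {n : ℕ} {c : Fin n → D} → Level c → D → Set
  InLevel {c = c} L x = AboveLo c (Level.lo L) x × BelowHi c (Level.hi L) x

  DistinctSets : (D → Set) → (D → Set) → Set
  DistinctSets P Q = ¬ (∀ x → P x ⇔ Q x)

  SetLt : (D → Set) → (D → Set) → Set
  SetLt P Q = ∀ p q → P p → Q q → p < q

{-# OPTIONS --safe #-}
module Submission where

-- Since G is closed and contains Aut(Δ), it suffices that G maps every finite injective
-- tuple to every tuple of the same order type; as Δ is homogeneous, it is enough that G can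
-- flip a single edge xy (x < y) of a tuple, preserving the order and all other edges.
-- Embed the tuple into Δ with x ↦ cᵢ, the points below x into L₁ and the points above x into
-- the lower or the upper of L₂, L₃ according to a downward closed cut, then apply f: this
-- flips exactly the edges between cᵢ and the points that landed in L₂. Doing this for the
-- cuts "≤ y" and "< y", which differ only at y, flips the edge xy once and every other edge
-- from x an even number of times.

open import Defs
open import Data.Nat using (ℕ; zero; suc; _+_)
open import Data.Nat.Properties using (+-comm)
open import Data.Fin using (Fin; zero; suc)
open import Data.Bool using (Bool; true; false; not; _xor_; if_then_else_)
import Data.Bool as Bool
open import Data.Bool.Properties using (¬-not; not-involutive)
import Data.Fin as Fin
open import Data.Product using (Σ; ∃; _×_; _,_; proj₁; proj₂; swap)
open import Data.Sum using (_⊎_; inj₁; inj₂; [_,_])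
open import Data.Empty using (⊥; ⊥-elim)
open import Data.Unit using (tt)
open import Data.Maybe using (just; nothing)
open import Data.List using (List; []; _∷_; map; filter; _++_; allFin; cartesianProduct; length; lookup; deduplicate)
open import Data.List.Relation.Unary.Unique.Propositional using (Unique; _∷_)
open import Data.List.Relation.Unary.Unique.DecPropositional.Properties using (deduplicate-!)
import Data.List.Relation.Unary.All as All
import Data.List.Relation.Unary.Any as Any
open import Data.List.Relation.Unary.Any.Properties using (lookup-index)
open import Data.List.Membership.Propositional using (_∈_)
open import Data.List.Membership.Propositional.Properties
  using (∈-map⁺; ∈-map⁻; ∈-++⁺ˡ; ∈-++⁺ʳ; ∈-++⁻; ∈-map∘filter⁺; ∈-map∘filter⁻; ∈-allFin;
         ∈-cartesianProduct⁺; ∈-lookup; ∈-deduplicate⁺)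
open import Data.List.Relation.Unary.Any using (here; there)
open import Function using (id; _∘_; _⇔_; mk⇔; Equivalence)
open import Function.Definitions using (Injective)
open import Function.Construct.Composition using (_↔-∘_)
open import Function.Construct.Symmetry using (↔-sym)
open import Function.Bundles using (Inverse; mk↔ₛ′)
import Function.Properties.Equivalence as ⇔
open import Relation.Nullary using (¬_; yes; no; does; ¬?)
open import Relation.Nullary.Decidable using (does-⇔; _×-dec_; dec-true; dec-false)
open import Relation.Unary using (Decidable)
open import Relation.Binary using (IsStrictTotalOrder; Tri; tri<; tri≈; tri>)
open import Relation.Binary.PropositionalEquality
  using (_≡_; _≢_; refl; sym; trans; cong; cong₂; subst; ≢-sym; module ≡-Reasoning)

lookup-injective : ∀ {A : Set} {xs : List A} → Unique xs → Injective _≡_ _≡_ (lookup xs)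
lookup-injective (_  ∷ _)  {zero}  {zero}  _ = refl
lookup-injective (x∉ ∷ _)  {zero}  {suc l} x≡ = ⊥-elim (All.lookup x∉ (∈-lookup l) x≡)
lookup-injective (x∉ ∷ _)  {suc j} {zero}  ≡x = ⊥-elim (All.lookup x∉ (∈-lookup j) (sym ≡x))
lookup-injective (_  ∷ xs!) {suc j} {suc l} eq = cong suc (lookup-injective xs! eq)

xor-cancelˡ : ∀ φ e → φ xor (φ xor e) ≡ e
xor-cancelˡ false e = refl
xor-cancelˡ true  e = not-involutive e

not-xor-cancelˡ : ∀ φ e → not φ xor (φ xor e) ≡ not e
not-xor-cancelˡ false e = refl
not-xor-cancelˡ true  e = refl

module OrderAndEdges {D : Set} (Δ : RandomOrderedGraph D) where
  open RandomOrderedGraph Δ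
  open Equivalence using (to; from)
  open IsStrictTotalOrder <-isSTO public using (compare; asym; _≟_; _<?_)
    renaming (trans to <-trans)
  open IsStrictTotalOrder <-isSTO using (irrefl)

  <-irrefl : ∀ {a} → ¬ (a < a)
  <-irrefl = irrefl refl

  <⇒≢ : ∀ {a b} → a < b → a ≢ b
  <⇒≢ a<b refl = <-irrefl a<b

  ≮∧≯⇒≡ : ∀ {a b} → ¬ (a < b) → ¬ (b < a) → a ≡ b
  ≮∧≯⇒≡ {a} {b} a≮b b≮a with compare a b
  ... | tri< a<b _ _ = ⊥-elim (a≮b a<b)
  ... | tri≈ _ a≡b _ = a≡b
  ... | tri> _ _ b<a = ⊥-elim (b≮a b<a)

  ≢⇒≯ᵇ≡<ᵇ : ∀ {a b} → a ≢ b → not (does (b <? a)) ≡ does (a <? b)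
  ≢⇒≯ᵇ≡<ᵇ {a} {b} a≢b with a <? b | b <? a
  ... | yes a<b | yes b<a = ⊥-elim (asym a<b b<a)
  ... | yes _   | no _    = refl
  ... | no _    | yes _   = refl
  ... | no a≮b  | no b≮a  = ⊥-elim (a≢b (≮∧≯⇒≡ a≮b b≮a))

  edge : D → D → Bool
  edge a b = does (E-dec a b)

  edge-irrefl : ∀ a → edge a a ≡ false
  edge-irrefl a with E-dec a a
  ... | yes e = ⊥-elim (E-irrefl a e)
  ... | no _  = refl

  edge-cong : ∀ {a b a′ b′} → E a b ⇔ E a′ b′ → edge a b ≡ edge a′ b′
  edge-cong {a} {b} {a′} {b′} e = does-⇔ e (E-dec a b) (E-dec a′ b′)

  E-sym-⇔ : ∀ a b → E a b ⇔ E b a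
  E-sym-⇔ a b = mk⇔ (E-sym a b) (E-sym b a)

  edge-sym : ∀ a b → edge a b ≡ edge b a
  edge-sym a b = edge-cong (E-sym-⇔ a b)

  edge-flip : ∀ {a b a′ b′} → E a b ⇔ (¬ E a′ b′) → edge a′ b′ ≡ not (edge a b)
  edge-flip {a} {b} {a′} {b′} e with E-dec a b | E-dec a′ b′
  ... | yes ab | yes a′b′ = ⊥-elim (to e ab a′b′)
  ... | yes _  | no _     = refl
  ... | no _   | yes _    = refl
  ... | no ¬ab | no ¬a′b′ = ⊥-elim (¬ab (from e ¬a′b′))

  edge≡⇒E⇔ : ∀ {a b a′ b′} → edge a b ≡ edge a′ b′ → E a b ⇔ E a′ b′
  edge≡⇒E⇔ {a} {b} {a′} {b′} eq with E-dec a b | E-dec a′ b′ | eq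
  ... | yes ab | yes a′b′ | _ = mk⇔ (λ _ → a′b′) (λ _ → ab)
  ... | no ¬ab | no ¬a′b′ | _ = mk⇔ (⊥-elim ∘ ¬ab) (⊥-elim ∘ ¬a′b′)
  ... | yes _  | no _     | ()
  ... | no _   | yes _    | ()

  dense : ∀ {a b} → a < b → ∃ λ y → a < y × y < b
  dense {a} {b} a<b with extension (a ∷ []) (b ∷ []) [] [] (λ { _ _ (here refl) (here refl) → a<b }) (λ _ ())
  ... | y , a<y , y<b , _ = y , a<y a (here refl) , y<b b (here refl)

  unbounded-above : ∀ a → ∃ λ y → a < y
  unbounded-above a with extension (a ∷ []) [] [] [] (λ _ _ _ ()) (λ _ ())
  ... | y , a<y , _ = y , a<y a (here refl)

  unbounded-below : ∀ b → ∃ λ y → y < b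
  unbounded-below b with extension [] (b ∷ []) [] [] (λ _ _ ()) (λ _ ())
  ... | y , _ , y<b , _ = y , y<b b (here refl)

module PartialIsomorphisms {D : Set} (Δ : RandomOrderedGraph D) where
  open RandomOrderedGraph Δ
  open Notions Δ
  open OrderAndEdges Δ
  open Equivalence using (to; from)

  Compatible : D × D → D × D → Set
  Compatible (a , b) (a′ , b′) = (a < a′ ⇔ b < b′) × (E a a′ ⇔ E b b′)

  IsPartialIso : List (D × D) → Set
  IsPartialIso P = ∀ {p q} → p ∈ P → q ∈ P → Compatible p q

  Fresh : D → List (D × D) → Set
  Fresh a P = ∀ {p} → p ∈ P → proj₁ p ≢ a

  compatible-refl : ∀ p → Compatible p p
  compatible-refl (a , b) =
    mk⇔ (⊥-elim ∘ <-irrefl) (⊥-elim ∘ <-irrefl) , mk⇔ (⊥-elim ∘ E-irrefl a) (⊥-elim ∘ E-irrefl b)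

  compatible-swap : ∀ {p q} → Compatible p q → Compatible (swap p) (swap q)
  compatible-swap (o , e) = ⇔.sym o , ⇔.sym e

  partialIso-functional : ∀ {P p q} → IsPartialIso P → p ∈ P → q ∈ P →
                          proj₁ p ≡ proj₁ q → proj₂ p ≡ proj₂ q
  partialIso-functional {P} {a , b} {a′ , b′} iso p∈ q∈ refl =
    ≮∧≯⇒≡ (λ b<b′ → <-irrefl (from (proj₁ (iso p∈ q∈)) b<b′))
                      (λ b′<b → <-irrefl (from (proj₁ (iso q∈ p∈)) b′<b))

  partialIso-injective : ∀ {P p q} → IsPartialIso P → p ∈ P → q ∈ P →
                         proj₂ p ≡ proj₂ q → proj₁ p ≡ proj₁ q
  partialIso-injective {P} {a , b} {a′ , b′} iso p∈ q∈ refl =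
    ≮∧≯⇒≡ (λ a<a′ → <-irrefl (to (proj₁ (iso p∈ q∈)) a<a′))
                      (λ a′<a → <-irrefl (to (proj₁ (iso q∈ p∈)) a′<a))

  partialIso-⊆ : ∀ {P Q} → (∀ {p} → p ∈ Q → p ∈ P) → IsPartialIso P → IsPartialIso Q
  partialIso-⊆ Q⊆P iso p∈ q∈ = iso (Q⊆P p∈) (Q⊆P q∈)

  partialIso-∷ : ∀ {p P} → (∀ {q} → q ∈ P → Compatible p q × Compatible q p) →
                 IsPartialIso P → IsPartialIso (p ∷ P)
  partialIso-∷ {p} new iso (here refl) (here refl) = compatible-refl p
  partialIso-∷ new iso (here refl) (there q∈)  = proj₁ (new q∈)
  partialIso-∷ new iso (there p∈)  (here refl) = proj₂ (new p∈)
  partialIso-∷ new iso (there p∈)  (there q∈)  = iso p∈ q∈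

  partialIso-swap : ∀ {P} → IsPartialIso P → IsPartialIso (map swap P)
  partialIso-swap iso p∈ q∈ with ∈-map⁻ swap p∈ | ∈-map⁻ swap q∈
  ... | p , p∈P , refl | q , q∈P , refl = compatible-swap (iso p∈P q∈P)

  imagesOf : {Q : D → Set} → Decidable Q → List (D × D) → List D
  imagesOf Q? P = map proj₂ (filter (Q? ∘ proj₁) P)

  ∈-imagesOf⁺ : ∀ {Q : D → Set} (Q? : Decidable Q) {P a b} → (a , b) ∈ P → Q a → b ∈ imagesOf Q? P
  ∈-imagesOf⁺ Q? {a = a} {b} ab∈P Qa = ∈-map∘filter⁺ proj₂ (Q? ∘ proj₁) ((a , b) , ab∈P , refl , Qa)

  ∈-imagesOf⁻ : ∀ {Q : D → Set} (Q? : Decidable Q) {P b} → b ∈ imagesOf Q? P →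
                ∃ λ a → (a , b) ∈ P × Q a
  ∈-imagesOf⁻ Q? b∈ with ∈-map∘filter⁻ proj₂ (Q? ∘ proj₁) b∈
  ... | (a , b) , ab∈P , refl , Qa = a , ab∈P , Qa

  module OnePointExtension
    {P : List (D × D)} (iso : IsPartialIso P) {a : D} (fresh : Fresh a P)
    (Lo Hi : List D) (Lo<Hi : ∀ {l h} → l ∈ Lo → h ∈ Hi → l < h)
    (below<Hi : ∀ {a′ b′ h} → (a′ , b′) ∈ P → a′ < a → h ∈ Hi → b′ < h)
    (Lo<above : ∀ {a′ b′ l} → (a′ , b′) ∈ P → a < a′ → l ∈ Lo → l < b′)
    where

    Lo′ Hi′ Adj NonAdj : List D
    Lo′    = Lo ++ imagesOf (_<? a) P
    Hi′    = Hi ++ imagesOf (a <?_) P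
    Adj    = imagesOf (E-dec a) P
    NonAdj = imagesOf (¬? ∘ E-dec a) P

    Lo′<Hi′ : ∀ l h → l ∈ Lo′ → h ∈ Hi′ → l < h
    Lo′<Hi′ l h l∈ h∈ with ∈-++⁻ Lo l∈ | ∈-++⁻ Hi h∈
    ... | inj₁ l∈Lo | inj₁ h∈Hi = Lo<Hi l∈Lo h∈Hi
    ... | inj₁ l∈Lo | inj₂ h∈′ with ∈-imagesOf⁻ (a <?_) h∈′
    ...   | _ , ah∈P , a<   = Lo<above ah∈P a< l∈Lo
    Lo′<Hi′ l h l∈ h∈ | inj₂ l∈′ | inj₁ h∈Hi with ∈-imagesOf⁻ (_<? a) l∈′
    ...   | _ , al∈P , <a   = below<Hi al∈P <a h∈Hi
    Lo′<Hi′ l h l∈ h∈ | inj₂ l∈′ | inj₂ h∈′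
      with ∈-imagesOf⁻ (_<? a) l∈′ | ∈-imagesOf⁻ (a <?_) h∈′
    ...   | _ , al∈P , <a | _ , ah∈P , a< = to (proj₁ (iso al∈P ah∈P)) (<-trans <a a<)

    Adj-disjoint : ∀ y → y ∈ Adj → y ∈ NonAdj → ⊥
    Adj-disjoint y y∈A y∈N with ∈-imagesOf⁻ (E-dec a) y∈A | ∈-imagesOf⁻ (¬? ∘ E-dec a) y∈N
    ... | a₁ , a₁y∈P , adj | a₂ , a₂y∈P , nonadj =
      nonadj (subst (E a) (partialIso-injective iso a₁y∈P a₂y∈P refl) adj)

    point : ∃ λ b → (∀ l → l ∈ Lo′ → l < b) × (∀ h → h ∈ Hi′ → b < h)
                  × (∀ y → y ∈ Adj → E b y) × (∀ y → y ∈ NonAdj → ¬ E b y × b ≢ y)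
    point = extension Lo′ Hi′ Adj NonAdj Lo′<Hi′ Adj-disjoint

    b : D
    b = proj₁ point

    Lo′<b : ∀ l → l ∈ Lo′ → l < b
    Lo′<b = proj₁ (proj₂ point)

    b<Hi′ : ∀ h → h ∈ Hi′ → b < h
    b<Hi′ = proj₁ (proj₂ (proj₂ point))

    b-Adj : ∀ y → y ∈ Adj → E b y
    b-Adj = proj₁ (proj₂ (proj₂ (proj₂ point)))

    b-NonAdj : ∀ y → y ∈ NonAdj → ¬ E b y × b ≢ y
    b-NonAdj = proj₂ (proj₂ (proj₂ (proj₂ point)))

    a<⇔b< : ∀ {a′ b′} → (a′ , b′) ∈ P → a < a′ ⇔ b < b′
    a<⇔b< {a′} {b′} ab′∈P =
      mk⇔ (λ a<a′ → b<Hi′ b′ (∈-++⁺ʳ Hi (∈-imagesOf⁺ (a <?_) ab′∈P a<a′))) reflect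
      where
      reflect : b < b′ → a < a′
      reflect b<b′ with compare a a′
      ... | tri< a<a′ _ _ = a<a′
      ... | tri≈ _ a≡a′ _ = ⊥-elim (fresh ab′∈P (sym a≡a′))
      ... | tri> _ _ a′<a = ⊥-elim (asym b<b′ (Lo′<b b′ (∈-++⁺ʳ Lo (∈-imagesOf⁺ (_<? a) ab′∈P a′<a))))

    <a⇔<b : ∀ {a′ b′} → (a′ , b′) ∈ P → a′ < a ⇔ b′ < b
    <a⇔<b {a′} {b′} ab′∈P =
      mk⇔ (λ a′<a → Lo′<b b′ (∈-++⁺ʳ Lo (∈-imagesOf⁺ (_<? a) ab′∈P a′<a))) reflect
      where
      reflect : b′ < b → a′ < a
      reflect b′<b with compare a a′
      ... | tri< a<a′ _ _ = ⊥-elim (asym b′<b (b<Hi′ b′ (∈-++⁺ʳ Hi (∈-imagesOf⁺ (a <?_) ab′∈P a<a′))))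
      ... | tri≈ _ a≡a′ _ = ⊥-elim (fresh ab′∈P (sym a≡a′))
      ... | tri> _ _ a′<a = a′<a

    Ea⇔Eb : ∀ {a′ b′} → (a′ , b′) ∈ P → E a a′ ⇔ E b b′
    Ea⇔Eb {a′} {b′} ab′∈P = mk⇔ (λ adj → b-Adj b′ (∈-imagesOf⁺ (E-dec a) ab′∈P adj)) reflect
      where
      reflect : E b b′ → E a a′
      reflect adj with E-dec a a′
      ... | yes adj′   = adj′
      ... | no nonadj′ = ⊥-elim (proj₁ (b-NonAdj b′ (∈-imagesOf⁺ (¬? ∘ E-dec a) ab′∈P nonadj′)) adj)

    extended-iso : IsPartialIso ((a , b) ∷ P)
    extended-iso = partialIso-∷ new iso
      where
      new : ∀ {q} → q ∈ P → Compatible (a , b) q × Compatible q (a , b)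
      new {a′ , b′} q∈ =
        (a<⇔b< q∈ , Ea⇔Eb q∈) ,
        (<a⇔<b q∈ , ⇔.trans (E-sym-⇔ a′ a) (⇔.trans (Ea⇔Eb q∈) (E-sym-⇔ b b′)))

    Lo<b : ∀ {l} → l ∈ Lo → l < b
    Lo<b l∈ = Lo′<b _ (∈-++⁺ˡ l∈)

    b<Hi : ∀ {h} → h ∈ Hi → b < h
    b<Hi h∈ = b<Hi′ _ (∈-++⁺ˡ h∈)

  lookup-or-fresh : ∀ a P → (∃ λ b → (a , b) ∈ P) ⊎ Fresh a P
  lookup-or-fresh a [] = inj₂ λ ()
  lookup-or-fresh a ((a′ , b′) ∷ P) with a′ ≟ a | lookup-or-fresh a P
  ... | yes refl | _                = inj₁ (b′ , here refl)
  ... | no _     | inj₁ (b , ab∈P)  = inj₁ (b , there ab∈P)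
  ... | no a′≢a  | inj₂ fresh       = inj₂ λ { (here refl) → a′≢a ; (there q∈) → fresh q∈ }

  extend-forth : ∀ {P} → IsPartialIso P → ∀ a → ∃ λ b → IsPartialIso ((a , b) ∷ P)
  extend-forth {P} iso a with lookup-or-fresh a P
  ... | inj₁ (b , ab∈P) = b , partialIso-⊆ (λ { (here refl) → ab∈P ; (there q∈) → q∈ }) iso
  ... | inj₂ fresh      = b , extended-iso
    where open OnePointExtension iso fresh [] [] (λ ()) (λ _ _ ()) (λ _ _ ())

  extend-back : ∀ {P} → IsPartialIso P → ∀ b → ∃ λ a → IsPartialIso ((a , b) ∷ P)
  extend-back {P} iso b with extend-forth (partialIso-swap iso) b
  ... | a , iso′ = a , partialIso-⊆ ⊆swap² (partialIso-swap iso′)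
    where
    ⊆swap² : ∀ {q} → q ∈ (a , b) ∷ P → q ∈ map swap ((b , a) ∷ map swap P)
    ⊆swap² (here refl) = here refl
    ⊆swap² (there q∈)  = there (∈-map⁺ swap (∈-map⁺ swap q∈))

  module BackAndForth {P₀ : List (D × D)} (iso₀ : IsPartialIso P₀) where

    mutual
      stage : ℕ → Σ (List (D × D)) IsPartialIso
      stage zero    = P₀ , iso₀
      stage (suc k) = (proj₁ (back-step k) , enum k) ∷ (enum k , proj₁ (forth-step k)) ∷ proj₁ (stage k) ,
                      proj₂ (back-step k)

      forth-step : ∀ k → ∃ λ b → IsPartialIso ((enum k , b) ∷ proj₁ (stage k))
      forth-step k = extend-forth (proj₂ (stage k)) (enum k)

      back-step : ∀ k → ∃ λ a →
                  IsPartialIso ((a , enum k) ∷ (enum k , proj₁ (forth-step k)) ∷ proj₁ (stage k))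
      back-step k = extend-back (proj₂ (forth-step k)) (enum k)

    Pairs : ℕ → List (D × D)
    Pairs k = proj₁ (stage k)

    Pairs-mono : ∀ d {k p} → p ∈ Pairs k → p ∈ Pairs (d + k)
    Pairs-mono zero    p∈ = p∈
    Pairs-mono (suc d) p∈ = there (there (Pairs-mono d p∈))

    Reached : D × D → Set
    Reached p = ∃ λ k → p ∈ Pairs k

    common-stage : ∀ {p q} → Reached p → Reached q → ∃ λ k → p ∈ Pairs k × q ∈ Pairs k
    common-stage {p} (k , p∈) (k′ , q∈) =
      k + k′ , subst (λ i → p ∈ Pairs i) (+-comm k′ k) (Pairs-mono k′ p∈) , Pairs-mono k q∈

    Reached-compatible : ∀ {p q} → Reached p → Reached q → Compatible p q
    Reached-compatible rp rq with common-stage rp rq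
    ... | k , p∈ , q∈ = proj₂ (stage k) p∈ q∈

    Reached-functional : ∀ {p q} → Reached p → Reached q → proj₁ p ≡ proj₁ q → proj₂ p ≡ proj₂ q
    Reached-functional rp rq with common-stage rp rq
    ... | k , p∈ , q∈ = partialIso-functional (proj₂ (stage k)) p∈ q∈

    Reached-injective : ∀ {p q} → Reached p → Reached q → proj₂ p ≡ proj₂ q → proj₁ p ≡ proj₁ q
    Reached-injective rp rq with common-stage rp rq
    ... | k , p∈ , q∈ = partialIso-injective (proj₂ (stage k)) p∈ q∈

    index : D → ℕ
    index x = proj₁ (enum-surj x)

    image preimage : D → D
    image x    = proj₁ (forth-step (index x))
    preimage y = proj₁ (back-step (index y))

    image-reached : ∀ x → Reached (x , image x)
    image-reached x =
      suc (index x) , subst (λ z → (z , image x) ∈ Pairs (suc (index x))) (proj₂ (enum-surj x)) (there (here refl))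

    preimage-reached : ∀ y → Reached (preimage y , y)
    preimage-reached y =
      suc (index y) , subst (λ z → (preimage y , z) ∈ Pairs (suc (index y))) (proj₂ (enum-surj y)) (here refl)

    permutation : Perm D
    permutation = mk↔ₛ′ image preimage
      (λ y → Reached-functional (image-reached (preimage y)) (preimage-reached y) refl)
      (λ x → Reached-injective (preimage-reached (image x)) (image-reached x) refl)

    permutation-aut : IsAut permutation
    permutation-aut = (λ x y → proj₁ (compatible x y)) , (λ x y → proj₂ (compatible x y))
      where
      compatible : ∀ x y → Compatible (x , image x) (y , image y)
      compatible x y = Reached-compatible (image-reached x) (image-reached y)

    permutation-extends : ∀ {a b} → (a , b) ∈ P₀ → image a ≡ b
    permutation-extends ab∈P₀ = Reached-functional (image-reached _) (zero , ab∈P₀) refl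

  homogeneous : ∀ {P} → IsPartialIso P →
                ∃ λ g → IsAut g × (∀ {a b} → (a , b) ∈ P → Inverse.to g a ≡ b)
  homogeneous iso = permutation , permutation-aut , permutation-extends
    where open BackAndForth iso

  SameOrder : ∀ {m} → (Fin m → D) → (Fin m → D) → Set
  SameOrder u v = ∀ j l → u j < u l ⇔ v j < v l

  SameEdges : ∀ {m} → (Fin m → D) → (Fin m → D) → Set
  SameEdges u v = ∀ j l → edge (u j) (u l) ≡ edge (v j) (v l)

  tuple-homogeneous : ∀ {m} {u v : Fin m → D} → SameOrder u v → SameEdges u v → SameOrbit IsAut u v
  tuple-homogeneous {m} {u} {v} order edges =
    proj₁ g , proj₁ (proj₂ g) , λ j → proj₂ (proj₂ g) (∈-map⁺ pair (∈-allFin j))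
    where
    pair : Fin m → D × D
    pair j = u j , v j
    iso : IsPartialIso (map pair (allFin m))
    iso p∈ q∈ with ∈-map⁻ pair p∈ | ∈-map⁻ pair q∈
    ... | j , _ , refl | l , _ , refl = order j l , edge≡⇒E⇔ (edges j l)
    g : ∃ λ g → IsAut g × (∀ {a b} → (a , b) ∈ map pair (allFin m) → Inverse.to g a ≡ b)
    g = homogeneous iso

  Interval : Set
  Interval = D × D

  _∈ᵢ_ : D → Interval → Set
  y ∈ᵢ (lo , hi) = lo < y × y < hi

  module IntervalEmbedding
    {P₀ : List (D × D)} (iso₀ : IsPartialIso P₀) (I : D → Interval)
    (I-nonempty : ∀ a → Fresh a P₀ → proj₁ (I a) < proj₂ (I a))
    (I-ordered : ∀ a a′ → Fresh a P₀ → Fresh a′ P₀ → a < a′ →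
                 I a ≡ I a′ ⊎ proj₂ (I a) < proj₁ (I a′))
    (I-P₀ : ∀ a → Fresh a P₀ → ∀ {a′ b′} → (a′ , b′) ∈ P₀ →
            (a′ < a → b′ < proj₂ (I a)) × (a < a′ → proj₁ (I a) < b′))
    where

    Placed : D × D → Set
    Placed (a , b) = (a , b) ∈ P₀ ⊎ (Fresh a P₀ × b ∈ᵢ I a)

    record Extension : Set where
      field
        pairs     : List (D × D)
        iso       : IsPartialIso pairs
        ⊇P₀       : ∀ {p} → p ∈ P₀ → p ∈ pairs
        placed    : ∀ {p} → p ∈ pairs → Placed p
    open Extension

    placed-below : ∀ {a a′ b′} → Fresh a P₀ → Placed (a′ , b′) → a′ < a → b′ < proj₂ (I a)
    placed-below {a} fresh (inj₁ ab′∈P₀) a′<a = proj₁ (I-P₀ a fresh ab′∈P₀) a′<a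
    placed-below {a} {a′} fresh (inj₂ (fresh′ , lo<b′ , b′<hi)) a′<a
      with I-ordered a′ a fresh′ fresh a′<a
    ... | inj₁ Ia′≡Ia      = subst (λ i → _ < proj₂ i) Ia′≡Ia b′<hi
    ... | inj₂ hiIa′<loIa = <-trans (<-trans b′<hi hiIa′<loIa) (I-nonempty a fresh)

    placed-above : ∀ {a a′ b′} → Fresh a P₀ → Placed (a′ , b′) → a < a′ → proj₁ (I a) < b′
    placed-above {a} fresh (inj₁ ab′∈P₀) a<a′ = proj₂ (I-P₀ a fresh ab′∈P₀) a<a′
    placed-above {a} {a′} fresh (inj₂ (fresh′ , lo<b′ , b′<hi)) a<a′
      with I-ordered a a′ fresh fresh′ a<a′
    ... | inj₁ Ia≡Ia′      = subst (λ i → proj₁ i < _) (sym Ia≡Ia′) lo<b′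
    ... | inj₂ hiIa<loIa′ = <-trans (<-trans (I-nonempty a fresh) hiIa<loIa′) lo<b′

    place-one : (e : Extension) (a : D) →
                Σ Extension λ e′ → (∀ {p} → p ∈ pairs e → p ∈ pairs e′) × ∃ λ b → (a , b) ∈ pairs e′
    place-one e a with lookup-or-fresh a (pairs e)
    ... | inj₁ (b , ab∈) = e , (λ p∈ → p∈) , b , ab∈
    ... | inj₂ fresh     = e′ , there , b , here refl
      where
      fresh₀ : Fresh a P₀
      fresh₀ p∈ = fresh (⊇P₀ e p∈)
      lo<hi : ∀ {l h} → l ∈ proj₁ (I a) ∷ [] → h ∈ proj₂ (I a) ∷ [] → l < h
      lo<hi (here refl) (here refl) = I-nonempty a fresh₀
      below<hi : ∀ {a′ b′ h} → (a′ , b′) ∈ pairs e → a′ < a → h ∈ proj₂ (I a) ∷ [] → b′ < h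
      below<hi ab′∈ a′<a (here refl) = placed-below fresh₀ (placed e ab′∈) a′<a
      lo<above : ∀ {a′ b′ l} → (a′ , b′) ∈ pairs e → a < a′ → l ∈ proj₁ (I a) ∷ [] → l < b′
      lo<above ab′∈ a<a′ (here refl) = placed-above fresh₀ (placed e ab′∈) a<a′
      open OnePointExtension (iso e) fresh (proj₁ (I a) ∷ []) (proj₂ (I a) ∷ []) lo<hi below<hi lo<above
      e′ : Extension
      e′ = record
        { pairs  = (a , b) ∷ pairs e
        ; iso    = extended-iso
        ; ⊇P₀    = there ∘ ⊇P₀ e
        ; placed = λ { (here refl) → inj₂ (fresh₀ , Lo<b (here refl) , b<Hi (here refl))
                     ; (there p∈)  → placed e p∈ }
        }

    place-all : (A : List D) → Σ Extension λ e → ∀ {a} → a ∈ A → ∃ λ b → (a , b) ∈ pairs e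
    place-all [] = record { pairs = P₀ ; iso = iso₀ ; ⊇P₀ = λ p∈ → p∈ ; placed = inj₁ } , λ ()
    place-all (a ∷ A) with place-all A
    ... | e , covers with place-one e a
    ...   | e′ , e⊆e′ , b , ab∈ = e′ , λ { (here refl) → b , ab∈
                                         ; (there a′∈) → proj₁ (covers a′∈) , e⊆e′ (proj₂ (covers a′∈)) }

    embed : ∀ {m} (u : Fin m → D) →
            ∃ λ w → (∀ j l → Compatible (u j , w j) (u l , w l)) × (∀ j → Placed (u j , w j))
    embed {m} u = w , (λ j l → iso e (w∈ j) (w∈ l)) , (λ j → placed e (w∈ j))
      where
      result : Σ Extension λ e → ∀ {a} → a ∈ map u (allFin m) → ∃ λ b → (a , b) ∈ pairs e
      result = place-all (map u (allFin m))
      e : Extension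
      e = proj₁ result
      w : Fin m → D
      w j = proj₁ (proj₂ result (∈-map⁺ u (∈-allFin j)))
      w∈ : ∀ j → (u j , w j) ∈ pairs e
      w∈ j = proj₂ (proj₂ result (∈-map⁺ u (∈-allFin j)))

  sameOrder-trans : ∀ {m} {u v w : Fin m → D} → SameOrder u v → SameOrder v w → SameOrder u w
  sameOrder-trans uv vw j l = ⇔.trans (uv j l) (vw j l)

  sameOrder-injective : ∀ {m} {u v : Fin m → D} → SameOrder u v → Injective _≡_ _≡_ u → Injective _≡_ _≡_ v
  sameOrder-injective {u = u} {v} uv u-inj {j} {l} vj≡vl with compare (u j) (u l)
  ... | tri< uj<ul _ _ = ⊥-elim (<-irrefl (subst (v j <_) (sym vj≡vl) (to (uv j l) uj<ul)))
  ... | tri≈ _ uj≡ul _ = u-inj uj≡ul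
  ... | tri> _ _ ul<uj = ⊥-elim (<-irrefl (subst (_< v j) (sym vj≡vl) (to (uv l j) ul<uj)))

  record FlipsOneEdge {m} (u v : Fin m → D) (x y : Fin m) : Set where
    field
      same-order  : SameOrder u v
      flipped     : edge (v x) (v y) ≡ not (edge (u x) (u y))
      others-kept : ∀ j l → ¬ (j ≡ x × l ≡ y) → ¬ (j ≡ y × l ≡ x) → edge (v j) (v l) ≡ edge (u j) (u l)

  flipsOneEdge-sym : ∀ {m} {u v : Fin m → D} {x y} → FlipsOneEdge u v x y → FlipsOneEdge u v y x
  flipsOneEdge-sym {u = u} {v} {x} {y} φ = record
    { same-order  = same-order
    ; flipped     = trans (edge-sym (v y) (v x)) (trans flipped (cong not (edge-sym (u x) (u y))))
    ; others-kept = λ j l j,l≢y,x j,l≢x,y → others-kept j l j,l≢x,y j,l≢y,x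
    }
    where open FlipsOneEdge φ

module LevelProperties {D : Set} (Δ : RandomOrderedGraph D) {n : ℕ} (c : Fin n → D) where
  open RandomOrderedGraph Δ
  open Notions Δ
  open OrderAndEdges Δ

  AboveLo-< : ∀ lo {y z} → AboveLo c lo y → y < z → AboveLo c lo z
  AboveLo-< nothing  _    _   = tt
  AboveLo-< (just j) cj<y y<z = <-trans cj<y y<z

  BelowHi-< : ∀ hi {y z} → BelowHi c hi y → z < y → BelowHi c hi z
  BelowHi-< nothing  _    _   = tt
  BelowHi-< (just j) y<cj z<y = <-trans z<y y<cj

  level-convex : ∀ (L : Level c) {a b y} → InLevel L a → InLevel L b → a < y → y < b → InLevel L y
  level-convex L (a-lo , _) (_ , b-hi) a<y y<b = AboveLo-< (Level.lo L) a-lo a<y , BelowHi-< (Level.hi L) b-hi y<b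

  level-avoids-constants : ∀ (L : Level c) j → ¬ InLevel L (c j)
  level-avoids-constants L j (lo<cj , cj<hi) = Level.consecutive L j lo<cj cj<hi

  level-nonConst : ∀ (L : Level c) {y} → InLevel L y → NonConst c y
  level-nonConst L y∈L j refl = level-avoids-constants L j y∈L

  level-nonempty : ∀ (L : Level c) → ∃ (InLevel L)
  level-nonempty L = point (Level.lo L) (Level.hi L) (Level.lo<hi L)
    where
    point : ∀ lo hi → (∀ i j → lo ≡ just i → hi ≡ just j → c i < c j) →
            ∃ λ y → AboveLo c lo y × BelowHi c hi y
    point nothing  nothing  _      = enum zero , tt , tt
    point (just i) nothing  _      = proj₁ (unbounded-above (c i)) , proj₂ (unbounded-above (c i)) , tt
    point nothing  (just j) _      = proj₁ (unbounded-below (c j)) , tt , proj₂ (unbounded-below (c j))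
    point (just i) (just j) ci<cj = dense (ci<cj i j refl refl)

  level-unbounded-above : ∀ (L : Level c) {y} → InLevel L y → ∃ λ z → y < z × InLevel L z
  level-unbounded-above L {y} y∈L@(_ , y-hi) with bound (Level.hi L) y-hi
    where
    bound : ∀ hi → BelowHi c hi y → ∃ λ z → y < z × BelowHi c hi z
    bound nothing  _    = proj₁ (unbounded-above y) , proj₂ (unbounded-above y) , tt
    bound (just j) y<cj = let z , y<z , z<cj = dense y<cj in z , y<z , z<cj
  ... | z , y<z , z-hi = z , y<z , AboveLo-< (Level.lo L) (proj₁ y∈L) y<z , z-hi

  level-unbounded-below : ∀ (L : Level c) {y} → InLevel L y → ∃ λ z → z < y × InLevel L z
  level-unbounded-below L {y} y∈L@(y-lo , _) with bound (Level.lo L) y-lo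
    where
    bound : ∀ lo → AboveLo c lo y → ∃ λ z → z < y × AboveLo c lo z
    bound nothing  _    = proj₁ (unbounded-below y) , proj₂ (unbounded-below y) , tt
    bound (just j) cj<y = let z , cj<z , z<y = dense cj<y in z , z<y , cj<z
  ... | z , z<y , z-lo = z , z<y , z-lo , BelowHi-< (Level.hi L) (proj₂ y∈L) z<y

  overlapping-levels-coincide : ∀ (L L′ : Level c) {x} → InLevel L x → InLevel L′ x →
                                ∀ {y} → InLevel L y → InLevel L′ y
  overlapping-levels-coincide L L′ {x} x∈L (x-lo′ , x-hi′) {y} y∈L =
    above (Level.lo L′) x-lo′ , below (Level.hi L′) x-hi′
    where
    outside : ∀ j → ¬ InLevel L (c j)
    outside = level-avoids-constants L
    above : ∀ lo → AboveLo c lo x → AboveLo c lo y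
    above nothing  _    = tt
    above (just j) cj<x with compare (c j) y
    ... | tri< cj<y _ _ = cj<y
    ... | tri≈ _ cj≡y _ = ⊥-elim (outside j (subst (InLevel L) (sym cj≡y) y∈L))
    ... | tri> _ _ y<cj = ⊥-elim (outside j (level-convex L y∈L x∈L y<cj cj<x))
    below : ∀ hi → BelowHi c hi x → BelowHi c hi y
    below nothing  _    = tt
    below (just j) x<cj with compare y (c j)
    ... | tri< y<cj _ _ = y<cj
    ... | tri≈ _ y≡cj _ = ⊥-elim (outside j (subst (InLevel L) y≡cj y∈L))
    ... | tri> _ _ cj<y = ⊥-elim (outside j (level-convex L x∈L y∈L x<cj cj<y))

  distinct-levels-disjoint : ∀ (L L′ : Level c) → DistinctSets (InLevel L) (InLevel L′) →
                             ∀ {x} → InLevel L x → InLevel L′ x → ⊥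
  distinct-levels-disjoint L L′ L≠L′ x∈L x∈L′ =
    L≠L′ λ y → mk⇔ (overlapping-levels-coincide L L′ x∈L x∈L′) (overlapping-levels-coincide L′ L x∈L′ x∈L)

module Orbits {D : Set} (Δ : RandomOrderedGraph D) (G : Perm D → Set)
  (isG : Notions.IsPermGroup Δ G) (Aut⊆G : ∀ g → Notions.IsAut Δ g → G g) where
  open RandomOrderedGraph Δ
  open Notions Δ
  open OrderAndEdges Δ
  open PartialIsomorphisms Δ
  open IsPermGroup isG

  orbit-trans : ∀ {m} {u v w : Fin m → D} → SameOrbit G u v → SameOrbit G v w → SameOrbit G u w
  orbit-trans (g , g∈G , gu≡v) (h , h∈G , hv≡w) =
    h ↔-∘ g , comp h g (h ↔-∘ g) (λ _ → refl) h∈G g∈G ,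
    λ j → trans (cong (Inverse.to h) (gu≡v j)) (hv≡w j)

  orbit-sym : ∀ {m} {u v : Fin m → D} → SameOrbit G u v → SameOrbit G v u
  orbit-sym (g , g∈G , gu≡v) =
    ↔-sym g , inv g (↔-sym g) (Inverse.strictlyInverseʳ g) g∈G , λ j → Inverse.inverseʳ g (sym (gu≡v j))

  orbit-of-aut : ∀ {m} {u v : Fin m → D} → SameOrbit IsAut u v → SameOrbit G u v
  orbit-of-aut (g , g-aut , gu≡v) = g , Aut⊆G g g-aut , gu≡v

  EdgeFlipsInG : Set
  EdgeFlipsInG = ∀ {m} (u : Fin m → D) → Injective _≡_ _≡_ u → ∀ x y → u x < u y →
                 ∃ λ v → SameOrbit G u v × FlipsOneEdge u v x y

  module _ (flip : EdgeFlipsInG) where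

    flip-any : ∀ {m} (u : Fin m → D) → Injective _≡_ _≡_ u → ∀ {x y} → x ≢ y →
               ∃ λ v → SameOrbit G u v × FlipsOneEdge u v x y
    flip-any u u-inj {x} {y} x≢y with compare (u x) (u y)
    ... | tri< ux<uy _ _ = flip u u-inj x y ux<uy
    ... | tri≈ _ ux≡uy _ = ⊥-elim (x≢y (u-inj ux≡uy))
    ... | tri> _ _ uy<ux = let v , u~v , φ = flip u u-inj y x uy<ux in v , u~v , flipsOneEdge-sym φ

    orbit-by-flips : ∀ {m} (Q : List (Fin m × Fin m)) {u v : Fin m → D} →
                     Injective _≡_ _≡_ u → SameOrder u v →
                     (∀ j l → edge (u j) (u l) ≡ edge (v j) (v l) ⊎ (j , l) ∈ Q) → SameOrbit G u v
    orbit-by-flips [] u-inj uv agree =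
      orbit-of-aut (tuple-homogeneous uv λ j l → [ id , (λ ()) ] (agree j l))
    orbit-by-flips {m} ((x , y) ∷ Q) {u} {v} u-inj uv agree with edge (u x) (u y) Bool.≟ edge (v x) (v y)
    ... | yes agree-xy = orbit-by-flips Q u-inj uv agree′
      where
      agree′ : ∀ j l → edge (u j) (u l) ≡ edge (v j) (v l) ⊎ (j , l) ∈ Q
      agree′ j l with agree j l
      ... | inj₁ e           = inj₁ e
      ... | inj₂ (here refl) = inj₁ agree-xy
      ... | inj₂ (there j,l∈Q) = inj₂ j,l∈Q
    ... | no differ-xy = orbit-trans (orbit-by-flips Q u-inj (sameOrder-trans uv same-order) agree′) (orbit-sym v~v′)
      where
      x≢y : x ≢ y
      x≢y refl = differ-xy (trans (edge-irrefl (u x)) (sym (edge-irrefl (v x))))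
      flip-xy : ∃ λ v′ → SameOrbit G v v′ × FlipsOneEdge v v′ x y
      flip-xy = flip-any v (sameOrder-injective uv u-inj) x≢y
      v′ : Fin m → D
      v′ = proj₁ flip-xy
      v~v′ : SameOrbit G v v′
      v~v′ = proj₁ (proj₂ flip-xy)
      open FlipsOneEdge (proj₂ (proj₂ flip-xy))
      open ≡-Reasoning
      agree′ : ∀ j l → edge (u j) (u l) ≡ edge (v′ j) (v′ l) ⊎ (j , l) ∈ Q
      agree′ j l with (j Fin.≟ x) ×-dec (l Fin.≟ y) | (j Fin.≟ y) ×-dec (l Fin.≟ x)
      ... | yes (refl , refl) | _ = inj₁ (trans (¬-not differ-xy) (sym flipped))
      ... | no _ | yes (refl , refl) = inj₁ (begin
        edge (u y) (u x)   ≡⟨ edge-sym (u y) (u x) ⟩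
        edge (u x) (u y)   ≡⟨ ¬-not differ-xy ⟩
        not (edge (v x) (v y)) ≡⟨ flipped ⟨
        edge (v′ x) (v′ y) ≡⟨ edge-sym (v′ x) (v′ y) ⟩
        edge (v′ y) (v′ x) ∎)
      ... | no j,l≢x,y | no j,l≢y,x with agree j l
      ...   | inj₁ e = inj₁ (trans e (sym (others-kept j l j,l≢x,y j,l≢y,x)))
      ...   | inj₂ (here refl) = ⊥-elim (j,l≢x,y (refl , refl))
      ...   | inj₂ (there j,l∈Q) = inj₂ j,l∈Q

    orbits-are-order-types : ∀ {m} {u v : Fin m → D} → Injective _≡_ _≡_ u → SameOrder u v → SameOrbit G u v
    orbits-are-order-types {m} u-inj uv =
      orbit-by-flips (cartesianProduct (allFin m) (allFin m)) u-inj uv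
        λ j l → inj₂ (∈-cartesianProduct⁺ (∈-allFin j) (∈-allFin l))

    order-automorphisms-in-G : Closed G → ∀ h → IsAutOrder h → G h
    order-automorphisms-in-G closed h h-order = closed h approximation
      where
      approximation : ∀ A → ∃ λ g → G g × (∀ a → a ∈ A → Inverse.to g a ≡ Inverse.to h a)
      approximation A = g , g∈G , agree
        where
        A′ : List D
        A′ = deduplicate _≟_ A
        u : Fin (length A′) → D
        u = lookup A′
        g∈orbit : SameOrbit G u (Inverse.to h ∘ u)
        g∈orbit = orbits-are-order-types (lookup-injective (deduplicate-! _≟_ A)) (λ j l → h-order (u j) (u l))
        g : Perm D
        g = proj₁ g∈orbit
        g∈G : G g
        g∈G = proj₁ (proj₂ g∈orbit)
        agree : ∀ a → a ∈ A → Inverse.to g a ≡ Inverse.to h a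
        agree a a∈A =
          subst (λ z → Inverse.to g z ≡ Inverse.to h z) (sym (lookup-index a∈A′))
                (proj₂ (proj₂ g∈orbit) (Any.index a∈A′))
          where
          a∈A′ : a ∈ A′
          a∈A′ = ∈-deduplicate⁺ _≟_ a∈A

module Regions {D : Set} (Δ : RandomOrderedGraph D) {n : ℕ} (c : Fin n → D) (i : Fin n) (f : D → D) where
  open RandomOrderedGraph Δ
  open Notions Δ
  open OrderAndEdges Δ
  open PartialIsomorphisms Δ

  cᵢ : D
  cᵢ = c i

  record Region : Set where
    field
      interval  : Interval
      nonempty  : proj₁ interval < proj₂ interval
      flip      : Bool
      behaviour : ∀ {y} → y ∈ᵢ interval → NonConst c y × edge (f cᵢ) (f y) ≡ flip xor edge cᵢ y
  open Region public

  record Layout : Set where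
    field
      below low high : Region
      below<cᵢ       : proj₂ (interval below) < cᵢ
      cᵢ<low         : cᵢ < proj₁ (interval low)
      low<high       : proj₂ (interval low) < proj₁ (interval high)
      below-kept     : flip below ≡ false
      high-opposite  : flip high ≡ not (flip low)

    upper : Bool → Region
    upper b = if b then low else high

    below<upper : ∀ b → proj₂ (interval below) < proj₁ (interval (upper b))
    below<upper true  = <-trans below<cᵢ cᵢ<low
    below<upper false = <-trans below<cᵢ (<-trans cᵢ<low (<-trans (nonempty low) low<high))

    cᵢ<upper : ∀ b → cᵢ < proj₁ (interval (upper b))
    cᵢ<upper true  = cᵢ<low
    cᵢ<upper false = <-trans cᵢ<low (<-trans (nonempty low) low<high)

    upper-ordered : ∀ b b′ → (b′ ≡ true → b ≡ true) →
                    upper b ≡ upper b′ ⊎ proj₂ (interval (upper b)) < proj₁ (interval (upper b′))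
    upper-ordered true  true  _ = inj₁ refl
    upper-ordered true  false _ = inj₂ low<high
    upper-ordered false false _ = inj₁ refl
    upper-ordered false true  b′⇒b with b′⇒b refl
    ... | ()

  module FromLevels
    (L₁ L₂ L₃ : Level c)
    (L₂≠L₃ : DistinctSets (InLevel L₂) (InLevel L₃))
    (L₁<cᵢ : SetLt (InLevel L₁) (Singleton cᵢ))
    (cᵢ<L₂ : SetLt (Singleton cᵢ) (InLevel L₂))
    (cᵢ<L₃ : SetLt (Singleton cᵢ) (InLevel L₃))
    (keeps : Keeps f (Singleton cᵢ) (InLevel L₁ ∪ InLevel L₃))
    (flips : Flips f (Singleton cᵢ) (InLevel L₂))
    where
    open LevelProperties Δ c

    regionIn : ∀ (L : Level c) (φ : Bool) → (∀ {y} → InLevel L y → edge (f cᵢ) (f y) ≡ φ xor edge cᵢ y) →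
               ∀ {a b} → InLevel L a → InLevel L b → a < b → Region
    regionIn L φ on-L {a} {b} a∈L b∈L a<b = record
      { interval  = a , b
      ; nonempty  = a<b
      ; flip      = φ
      ; behaviour = λ (a<y , y<b) → let y∈L = level-convex L a∈L b∈L a<y y<b in level-nonConst L y∈L , on-L y∈L
      }

    cᵢ≢ : ∀ (L : Level c) {y} → InLevel L y → cᵢ ≢ y
    cᵢ≢ L y∈L cᵢ≡y = level-nonConst L y∈L i (sym cᵢ≡y)

    kept-on-L₁ : ∀ {y} → InLevel L₁ y → edge (f cᵢ) (f y) ≡ false xor edge cᵢ y
    kept-on-L₁ y∈L₁ = sym (edge-cong (keeps cᵢ _ refl (inj₁ y∈L₁) (cᵢ≢ L₁ y∈L₁)))

    kept-on-L₃ : ∀ {y} → InLevel L₃ y → edge (f cᵢ) (f y) ≡ false xor edge cᵢ y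
    kept-on-L₃ y∈L₃ = sym (edge-cong (keeps cᵢ _ refl (inj₂ y∈L₃) (cᵢ≢ L₃ y∈L₃)))

    flipped-on-L₂ : ∀ {y} → InLevel L₂ y → edge (f cᵢ) (f y) ≡ true xor edge cᵢ y
    flipped-on-L₂ y∈L₂ = edge-flip (flips cᵢ _ refl y∈L₂ (cᵢ≢ L₂ y∈L₂))

    layout : Layout
    layout with level-nonempty L₁ | level-nonempty L₂ | level-nonempty L₃
    ... | p₁ , p₁∈L₁ | p₂ , p₂∈L₂ | p₃ , p₃∈L₃ with level-unbounded-below L₁ p₁∈L₁
    ... | q₁ , q₁<p₁ , q₁∈L₁ = by-order (compare p₂ p₃)
      where
      below : Region
      below = regionIn L₁ false kept-on-L₁ q₁∈L₁ p₁∈L₁ q₁<p₁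

      by-order : Tri (p₂ < p₃) (p₂ ≡ p₃) (p₃ < p₂) → Layout
      by-order (tri< p₂<p₃ _ _)
        with level-unbounded-below L₂ p₂∈L₂ | level-unbounded-above L₃ p₃∈L₃
      ... | q₂ , q₂<p₂ , q₂∈L₂ | r₃ , p₃<r₃ , r₃∈L₃ = record
        { below         = below
        ; low           = regionIn L₂ true flipped-on-L₂ q₂∈L₂ p₂∈L₂ q₂<p₂
        ; high          = regionIn L₃ false kept-on-L₃ p₃∈L₃ r₃∈L₃ p₃<r₃
        ; below<cᵢ      = L₁<cᵢ p₁ cᵢ p₁∈L₁ refl
        ; cᵢ<low        = cᵢ<L₂ cᵢ q₂ refl q₂∈L₂
        ; low<high      = p₂<p₃
        ; below-kept    = refl
        ; high-opposite = refl
        }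
      by-order (tri≈ _ refl _) = ⊥-elim (distinct-levels-disjoint L₂ L₃ L₂≠L₃ p₂∈L₂ p₃∈L₃)
      by-order (tri> _ _ p₃<p₂)
        with level-unbounded-below L₃ p₃∈L₃ | level-unbounded-above L₂ p₂∈L₂
      ... | q₃ , q₃<p₃ , q₃∈L₃ | r₂ , p₂<r₂ , r₂∈L₂ = record
        { below         = below
        ; low           = regionIn L₃ false kept-on-L₃ q₃∈L₃ p₃∈L₃ q₃<p₃
        ; high          = regionIn L₂ true flipped-on-L₂ p₂∈L₂ r₂∈L₂ p₂<r₂
        ; below<cᵢ      = L₁<cᵢ p₁ cᵢ p₁∈L₁ refl
        ; cᵢ<low        = cᵢ<L₃ cᵢ q₃ refl q₃∈L₃
        ; low<high      = p₃<p₂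
        ; below-kept    = refl
        ; high-opposite = refl
        }

module EdgeFlips
  {D : Set} (Δ : RandomOrderedGraph D)
  (G : Perm D → Set) (isG : Notions.IsPermGroup Δ G) (Aut⊆G : ∀ g → Notions.IsAut Δ g → G g)
  {n : ℕ} (c : Fin n → D) (i : Fin n) (f : D → D)
  (f-order : Notions.OrderPreserving Δ f) (f-gen : Notions.GeneratedBy Δ G f)
  (f-keeps : Notions.Keeps Δ f (Notions.NonConst Δ c) (Notions.NonConst Δ c))
  (layout : Regions.Layout Δ c i f)
  where
  open RandomOrderedGraph Δ
  open Notions Δ
  open OrderAndEdges Δ
  open PartialIsomorphisms Δ
  open Orbits Δ G isG Aut⊆G
  open Regions Δ c i f
  open Layout layout
  open Equivalence using (to)

  f-reflects-order : ∀ {a b} → f a < f b → a < b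
  f-reflects-order {a} {b} fa<fb with compare a b
  ... | tri< a<b _ _ = a<b
  ... | tri≈ _ refl _ = ⊥-elim (<-irrefl fa<fb)
  ... | tri> _ _ b<a = ⊥-elim (asym fa<fb (f-order b a b<a))

  f-orbit : ∀ {m} (w : Fin m → D) → SameOrbit G w (f ∘ w)
  f-orbit {m} w with f-gen (map w (allFin m))
  ... | g , g∈G , g≡f = g , g∈G , λ j → g≡f (w j) (∈-map⁺ w (∈-allFin j))

  f-keeps-edge : ∀ {a b} → NonConst c a → NonConst c b → edge (f a) (f b) ≡ edge a b
  f-keeps-edge {a} {b} a-nc b-nc with a ≟ b
  ... | yes refl = trans (edge-irrefl (f a)) (sym (edge-irrefl a))
  ... | no a≢b   = sym (edge-cong (f-keeps a b a-nc b-nc a≢b))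

  DownwardClosed : (D → Bool) → Set
  DownwardClosed Low = ∀ {a b} → a < b → Low b ≡ true → Low a ≡ true

  record Rewiring {m} (u v : Fin m → D) (x : Fin m) (Low : D → Bool) : Set where
    field
      in-orbit        : SameOrbit G u v
      same-order      : SameOrder u v
      kept-off-x      : ∀ j l → u j ≢ u x → u l ≢ u x → edge (v j) (v l) ≡ edge (u j) (u l)
      kept-below-x    : ∀ l → u l < u x → edge (v x) (v l) ≡ edge (u x) (u l)
      shifted-above-x : ∀ l → u x < u l → edge (v x) (v l) ≡ flip (upper (Low (u l))) xor edge (u x) (u l)

  rewire : ∀ {m} (u : Fin m → D) (x : Fin m) (Low : D → Bool) → DownwardClosed Low →
              ∃ λ v → Rewiring u v x Low
  rewire {m} u x Low Low-closed = f ∘ w , record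
    { in-orbit        = orbit-trans (orbit-of-aut (tuple-homogeneous u≈w-order u≈w-edges)) (f-orbit w)
    ; same-order      = λ j l → ⇔.trans (u≈w-order j l) (mk⇔ (f-order (w j) (w l)) f-reflects-order)
    ; kept-off-x      = λ j l uj≢ux ul≢ux →
                          trans (f-keeps-edge (non-constant j uj≢ux) (non-constant l ul≢ux)) (sym (u≈w-edges j l))
    ; kept-below-x    = λ l ul<ux → trans (edges-from-x l (<⇒≢ ul<ux))
                          (cong (_xor _) (trans (cong flip (regionOf-below ul<ux)) below-kept))
    ; shifted-above-x = λ l ux<ul → trans (edges-from-x l (≢-sym (<⇒≢ ux<ul)))
                          (cong (λ R → flip R xor _) (regionOf-above ux<ul))
    }
    where
    regionOf : D → Region
    regionOf a = if does (a <? u x) then below else upper (Low a)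

    regionOf-below : ∀ {a} → a < u x → regionOf a ≡ below
    regionOf-below {a} a<ux rewrite dec-true (a <? u x) a<ux = refl

    regionOf-above : ∀ {a} → u x < a → regionOf a ≡ upper (Low a)
    regionOf-above {a} ux<a rewrite dec-false (a <? u x) (asym ux<a) = refl

    I : D → Interval
    I = interval ∘ regionOf

    P₀ : List (D × D)
    P₀ = (u x , cᵢ) ∷ []

    iso₀ : IsPartialIso P₀
    iso₀ (here refl) (here refl) = compatible-refl _

    ordered : ∀ a a′ → Fresh a P₀ → Fresh a′ P₀ → a < a′ → I a ≡ I a′ ⊎ proj₂ (I a) < proj₁ (I a′)
    ordered a a′ a-fresh a′-fresh a<a′ = by-position (compare a (u x)) (compare a′ (u x))
      where
      by-position : Tri (a < u x) (a ≡ u x) (u x < a) → Tri (a′ < u x) (a′ ≡ u x) (u x < a′) →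
                    I a ≡ I a′ ⊎ proj₂ (I a) < proj₁ (I a′)
      by-position (tri< a<ux _ _) (tri< a′<ux _ _) rewrite regionOf-below a<ux | regionOf-below a′<ux = inj₁ refl
      by-position (tri< a<ux _ _) (tri> _ _ ux<a′) rewrite regionOf-below a<ux | regionOf-above ux<a′ =
        inj₂ (below<upper (Low a′))
      by-position (tri> _ _ ux<a) (tri< a′<ux _ _) = ⊥-elim (asym (<-trans ux<a a<a′) a′<ux)
      by-position (tri> _ _ ux<a) (tri> _ _ ux<a′) rewrite regionOf-above ux<a | regionOf-above ux<a′ =
        [ inj₁ ∘ cong interval , inj₂ ] (upper-ordered (Low a) (Low a′) (Low-closed a<a′))
      by-position (tri≈ _ a≡ux _) _ = ⊥-elim (a-fresh (here refl) (sym a≡ux))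
      by-position _ (tri≈ _ a′≡ux _) = ⊥-elim (a′-fresh (here refl) (sym a′≡ux))

    around-cᵢ : ∀ a → Fresh a P₀ → ∀ {a′ b′} → (a′ , b′) ∈ P₀ →
                (a′ < a → b′ < proj₂ (I a)) × (a < a′ → proj₁ (I a) < b′)
    around-cᵢ a a-fresh (here refl) =
      (λ ux<a → subst (λ R → cᵢ < proj₂ (interval R)) (sym (regionOf-above ux<a))
                  (<-trans (cᵢ<upper (Low a)) (nonempty (upper (Low a))))) ,
      (λ a<ux → subst (λ R → proj₁ (interval R) < cᵢ) (sym (regionOf-below a<ux))
                  (<-trans (nonempty below) below<cᵢ))

    open IntervalEmbedding iso₀ I (λ a _ → nonempty (regionOf a)) ordered around-cᵢ

    embedding : ∃ λ w → (∀ j l → Compatible (u j , w j) (u l , w l)) × (∀ j → Placed (u j , w j))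
    embedding = embed u

    w : Fin m → D
    w = proj₁ embedding

    u≈w-order : SameOrder u w
    u≈w-order j l = proj₁ (proj₁ (proj₂ embedding) j l)

    u≈w-edges : SameEdges u w
    u≈w-edges j l = edge-cong (proj₂ (proj₁ (proj₂ embedding) j l))

    w-x : w x ≡ cᵢ
    w-x with proj₂ (proj₂ embedding) x
    ... | inj₁ (here eq)       = cong proj₂ eq
    ... | inj₂ (ux-fresh , _)  = ⊥-elim (ux-fresh (here refl) refl)

    w-in-region : ∀ j → u j ≢ u x → w j ∈ᵢ I (u j)
    w-in-region j uj≢ux with proj₂ (proj₂ embedding) j
    ... | inj₁ (here eq) = ⊥-elim (uj≢ux (cong proj₁ eq))
    ... | inj₂ (_ , w∈)  = w∈

    non-constant : ∀ j → u j ≢ u x → NonConst c (w j)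
    non-constant j uj≢ux = proj₁ (behaviour (regionOf (u j)) (w-in-region j uj≢ux))

    edges-from-x : ∀ l → u l ≢ u x → edge (f (w x)) (f (w l)) ≡ flip (regionOf (u l)) xor edge (u x) (u l)
    edges-from-x l ul≢ux = begin
      edge (f (w x)) (f (w l))                    ≡⟨ cong (λ z → edge (f z) (f (w l))) w-x ⟩
      edge (f cᵢ) (f (w l))                       ≡⟨ proj₂ (behaviour (regionOf (u l)) (w-in-region l ul≢ux)) ⟩
      flip (regionOf (u l)) xor edge cᵢ (w l)     ≡⟨ cong (λ z → flip (regionOf (u l)) xor edge z (w l)) w-x ⟨
      flip (regionOf (u l)) xor edge (w x) (w l)  ≡⟨ cong (flip (regionOf (u l)) xor_) (u≈w-edges x l) ⟨
      flip (regionOf (u l)) xor edge (u x) (u l)  ∎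
      where open ≡-Reasoning

  edge-flips-in-G : EdgeFlipsInG
  edge-flips-in-G {m} u u-inj x y ux<uy = v₂ , orbit-trans in-orbit₁ in-orbit₂ , record
    { same-order  = sameOrder-trans same-order₁ same-order₂
    ; flipped     = flipped-xy
    ; others-kept = others-kept
    }
    where
    Low₁ : D → Bool
    Low₁ a = not (does (u y <? a))

    Low₁-closed : DownwardClosed Low₁
    Low₁-closed {a} {b} a<b Low₁-b with u y <? a | u y <? b
    ... | no _      | _          = refl
    ... | yes uy<a  | no uy≮b    = ⊥-elim (uy≮b (<-trans uy<a a<b))
    ... | yes _     | yes _      = Low₁-b

    step₁ : ∃ λ v₁ → Rewiring u v₁ x Low₁
    step₁ = rewire u x Low₁ Low₁-closed
    v₁ : Fin m → D
    v₁ = proj₁ step₁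
    open Rewiring (proj₂ step₁) renaming
      (in-orbit to in-orbit₁; same-order to same-order₁; kept-off-x to kept-off-x₁;
       kept-below-x to kept-below-x₁; shifted-above-x to shifted-above-x₁)

    Low₂ : D → Bool
    Low₂ a = does (a <? v₁ y)

    Low₂-closed : DownwardClosed Low₂
    Low₂-closed {a} {b} a<b Low₂-b with a <? v₁ y | b <? v₁ y
    ... | yes _     | _          = refl
    ... | no a≮v₁y  | yes b<v₁y  = ⊥-elim (a≮v₁y (<-trans a<b b<v₁y))
    ... | no _      | no _       = Low₂-b

    step₂ : ∃ λ v₂ → Rewiring v₁ v₂ x Low₂
    step₂ = rewire v₁ x Low₂ Low₂-closed
    v₂ : Fin m → D
    v₂ = proj₁ step₂
    open Rewiring (proj₂ step₂) renaming
      (in-orbit to in-orbit₂; same-order to same-order₂; kept-off-x to kept-off-x₂;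
       kept-below-x to kept-below-x₂; shifted-above-x to shifted-above-x₂)

    v₁-inj : Injective _≡_ _≡_ v₁
    v₁-inj = sameOrder-injective same-order₁ u-inj

    same-side : ∀ l → l ≢ y → Low₁ (u l) ≡ Low₂ (v₁ l)
    same-side l l≢y =
      trans (≢⇒≯ᵇ≡<ᵇ (λ ul≡uy → l≢y (u-inj ul≡uy))) (does-⇔ (same-order₁ l y) (u l <? u y) (v₁ l <? v₁ y))

    row-kept : ∀ l → l ≢ y → edge (v₂ x) (v₂ l) ≡ edge (u x) (u l)
    row-kept l l≢y with compare (u l) (u x)
    ... | tri< ul<ux _ _ = trans (kept-below-x₂ l (to (same-order₁ l x) ul<ux)) (kept-below-x₁ l ul<ux)
    ... | tri≈ _ ul≡ux _ rewrite u-inj ul≡ux = trans (edge-irrefl (v₂ x)) (sym (edge-irrefl (u x)))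
    ... | tri> _ _ ux<ul = begin
      edge (v₂ x) (v₂ l)
        ≡⟨ shifted-above-x₂ l (to (same-order₁ x l) ux<ul) ⟩
      flip (upper (Low₂ (v₁ l))) xor edge (v₁ x) (v₁ l)
        ≡⟨ cong (λ b → flip (upper b) xor edge (v₁ x) (v₁ l)) (same-side l l≢y) ⟨
      φ xor edge (v₁ x) (v₁ l)
        ≡⟨ cong (φ xor_) (shifted-above-x₁ l ux<ul) ⟩
      φ xor (φ xor edge (u x) (u l))
        ≡⟨ xor-cancelˡ φ (edge (u x) (u l)) ⟩
      edge (u x) (u l)
        ∎
      where
      open ≡-Reasoning
      φ : Bool
      φ = flip (upper (Low₁ (u l)))

    flipped-xy : edge (v₂ x) (v₂ y) ≡ not (edge (u x) (u y))
    flipped-xy = begin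
      edge (v₂ x) (v₂ y)
        ≡⟨ shifted-above-x₂ y (to (same-order₁ x y) ux<uy) ⟩
      flip (upper (Low₂ (v₁ y))) xor edge (v₁ x) (v₁ y)
        ≡⟨ cong (λ b → flip (upper b) xor edge (v₁ x) (v₁ y)) (dec-false (v₁ y <? v₁ y) <-irrefl) ⟩
      flip high xor edge (v₁ x) (v₁ y)
        ≡⟨ cong₂ _xor_ high-opposite (shifted-above-x₁ y ux<uy) ⟩
      not (flip low) xor (flip (upper (Low₁ (u y))) xor edge (u x) (u y))
        ≡⟨ cong (λ b → not (flip low) xor (flip (upper (not b)) xor edge (u x) (u y))) (dec-false (u y <? u y) <-irrefl) ⟩
      not (flip low) xor (flip low xor edge (u x) (u y))
        ≡⟨ not-xor-cancelˡ (flip low) (edge (u x) (u y)) ⟩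
      not (edge (u x) (u y))
        ∎
      where open ≡-Reasoning

    others-kept : ∀ j l → ¬ (j ≡ x × l ≡ y) → ¬ (j ≡ y × l ≡ x) → edge (v₂ j) (v₂ l) ≡ edge (u j) (u l)
    others-kept j l ¬xy ¬yx with j Fin.≟ x | l Fin.≟ x
    ... | yes refl | _        = row-kept l λ l≡y → ¬xy (refl , l≡y)
    ... | no _     | yes refl = begin
      edge (v₂ j) (v₂ x) ≡⟨ edge-sym (v₂ j) (v₂ x) ⟩
      edge (v₂ x) (v₂ j) ≡⟨ row-kept j (λ j≡y → ¬yx (j≡y , refl)) ⟩
      edge (u x) (u j)   ≡⟨ edge-sym (u x) (u j) ⟩
      edge (u j) (u x)   ∎
      where open ≡-Reasoning
    ... | no j≢x   | no l≢x   =
      trans (kept-off-x₂ j l (j≢x ∘ v₁-inj) (l≢x ∘ v₁-inj)) (kept-off-x₁ j l (j≢x ∘ u-inj) (l≢x ∘ u-inj))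

mainTheorem3 : {D : Set} (Δ : RandomOrderedGraph D) →
    let open Notions Δ in
    (G : Perm D → Set) → IsPermGroup G → Closed G → (∀ g → IsAut g → G g) →
    (n : ℕ) (c : Fin n → D) (f : D → D) →
    OrderPreserving f → Canonical c f → GeneratedBy G f →
    Keeps f (NonConst c) (NonConst c) →
    (L₁ L₂ L₃ : Level c) (i : Fin n) →
    DistinctSets (InLevel L₁) (InLevel L₂) →
    DistinctSets (InLevel L₁) (InLevel L₃) →
    DistinctSets (InLevel L₂) (InLevel L₃) →
    SetLt (InLevel L₁) (Singleton (c i)) → SetLt (Singleton (c i)) (InLevel L₂) →
    SetLt (Singleton (c i)) (InLevel L₃) →
    Keeps f (Singleton (c i)) (InLevel L₁ ∪ InLevel L₃) →
    Flips f (Singleton (c i)) (InLevel L₂) →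
    (∀ g → IsAutOrder g → G g)
mainTheorem3 Δ G isG closed Aut⊆G n c f f-order _ f-gen f-keeps L₁ L₂ L₃ i _ _ L₂≠L₃
             L₁<cᵢ cᵢ<L₂ cᵢ<L₃ keeps flips =
  order-automorphisms-in-G edge-flips-in-G closed
  where
  open Orbits Δ G isG Aut⊆G
  open Regions.FromLevels Δ c i f L₁ L₂ L₃ L₂≠L₃ L₁<cᵢ cᵢ<L₂ cᵢ<L₃ keeps flips
  open EdgeFlips Δ G isG Aut⊆G c i f f-order f-gen f-keeps layout
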